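{- Let $\Upsilon:\mathfrak{Q}\to\mathfrak{R}$, $\Upsilon^{\diamond}$, $\Upsilon^{\star}$ be as defined in the context. For a quiver $Q$ and an incidence hypergraph $G$, the Frobenius morphism $\Phi:\Upsilon^{\diamond}(\Upsilon(Q)\times G)\to Q\times\Upsilon^{\diamond}(G)$ in $\mathfrak{Q}$ is given by $\overrightarrow{V}(\Phi)(n,v,x)=(v,n,x)$ and $\overrightarrow{E}(\Phi)=\mathrm{id}_{\overrightarrow{E}(Q)\times I(G)}$. Moreover, $(\Upsilon^{\diamond},\Upsilon,\Upsilon^{\star})$ is an atomic geometric surjection from $\mathfrak{R}$ to $\mathfrak{Q}$ which is not an embedding. Furthermore, $\Upsilon^{\diamond}$ is faithful, and $\mathfrak{R}$ is equivalent to the slice category $\mathfrak{Q}/\overrightarrow{E}^{\diamond}(\{1\})$.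
   Context: A quiver $Q$ consists of sets $\overrightarrow{V}(Q)$, $\overrightarrow{E}(Q)$ and functions $\sigma_Q,\tau_Q:\overrightarrow{E}(Q)\to\overrightarrow{V}(Q)$; morphisms are pairs of functions commuting with $\sigma,\tau$; category $\mathfrak{Q}$, products componentwise. An incidence hypergraph $G$ consists of sets $\check V(G)$, $\check E(G)$, $I(G)$ and functions $\varsigma_G:I(G)\to\check V(G)$, $\omega_G:I(G)\to\check E(G)$; morphisms are triples of functions commuting with $\varsigma,\omega$; category $\mathfrak{R}$, products componentwise. $\Upsilon(Q)$ is the incidence hypergraph with $\check V=\check E=\overrightarrow{V}(Q)$, $I=\overrightarrow{E}(Q)$, $\varsigma=\sigma_Q$, $\omega=\tau_Q$, and $\Upsilon(\phi)=(\overrightarrow{V}(\phi),\overrightarrow{V}(\phi),\overrightarrow{E}(\phi))$. Its left adjoint $\Upsilon^{\diamond}(G)$ is the quiver with vertex set $(\{1\}\times\check V(G))\cup(\{2\}\times\check E(G))$, edge set $I(G)$, source $i\mapsto(1,\varsigma_G(i))$, target $i\mapsto(2,\omega_G(i))$; its right adjoint $\Upsilon^{\star}(G)$ is the quiver with vertices $\check V(G)\times\check E(G)$, edges $\check V(G)\times I(G)\times\check E(G)$, source $(v,i,e)\mapsto(\varsigma_G(i),e)$, target $(v,i,e)\mapsto(v,\omega_G(i))$. The counit $\Upsilon^{\diamond}\Upsilon(Q)\to Q$ is $(n,v)\mapsto v$ on vertices and the identity on edges. Vertices of $\Upsilon^{\diamond}(\Upsilon(Q)\times G)$ are written $(1,v,x)$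 with $v\in\overrightarrow{V}(Q),x\in\check V(G)$ or $(2,v,x)$ with $x\in\check E(G)$. $\overrightarrow{E}^{\diamond}(\{1\})$ is the quiver with two vertices and one edge between them (directed path of length 1). For an adjunction $L\dashv F$ with $F$ preserving products and counit $\varepsilon$, the Frobenius morphism $L(F(A)\times B)\to A\times L(B)$ has components $\varepsilon_A\circ L(\pi_{F(A)})$ and $L(\pi_B)$. A triple $(L,F,F^\star)$ with $L\dashv F\dashv F^\star$, $F:\mathcal{F}\to\mathcal{E}$ between topoi, is an essential geometric morphism $\mathcal{E}\to\mathcal{F}$ with inverse image $F$; it is atomic if $F$ is logical, a surjection if $F$ is faithful, an embedding if $F^\star$ is full and faithful. -}

module Defs where

open import Level using (Level; _⊔_; suc; Lift; lift)
open import Data.Product using (Σ; _×_; _,_; proj₁; proj₂; ∃-syntax)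
open import Data.Sum using (_⊎_; inj₁; inj₂; [_,_]′)
open import Data.Unit.Polymorphic using (⊤; tt)
open import Relation.Binary.PropositionalEquality
  using (_≡_; refl; sym; trans; cong)
open import Relation.Nullary using (¬_)
open import Function using (_∘′_; id)

-- A minimal category-theory vocabulary (hom-setoids, no funext needed)

record Category (o h : Level) : Set (Level.suc (o ⊔ h)) where
  infixr 9 _∘_
  infix  4 _≈_
  field
    Obj  : Set o
    Hom  : Obj → Obj → Set h
    _≈_  : ∀ {A B} → Hom A B → Hom A B → Set h
    idC  : ∀ {A} → Hom A A
    _∘_  : ∀ {A B C} → Hom B C → Hom A B → Hom A C
    ≈-refl  : ∀ {A B} {f : Hom A B} → f ≈ f
    ≈-sym   : ∀ {A B} {f g : Hom A B} → f ≈ g → g ≈ f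
    ≈-trans : ∀ {A B} {f g k : Hom A B} → f ≈ g → g ≈ k → f ≈ k
    identityˡ : ∀ {A B} {f : Hom A B} → idC ∘ f ≈ f
    identityʳ : ∀ {A B} {f : Hom A B} → f ∘ idC ≈ f
    assoc : ∀ {A B C D} {f : Hom A B} {g : Hom B C} {k : Hom C D} →
            (k ∘ g) ∘ f ≈ k ∘ (g ∘ f)
    ∘-resp-≈ : ∀ {A B C} {f f′ : Hom B C} {g g′ : Hom A B} →
               f ≈ f′ → g ≈ g′ → f ∘ g ≈ f′ ∘ g′

record Functor {o₁ h₁ o₂ h₂ : Level}
               (C : Category o₁ h₁) (D : Category o₂ h₂)
               : Set (o₁ ⊔ h₁ ⊔ o₂ ⊔ h₂) where
  private
    module C = Category C
    module D = Category D
  field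
    F₀ : C.Obj → D.Obj
    F₁ : ∀ {A B} → C.Hom A B → D.Hom (F₀ A) (F₀ B)
    identity : ∀ {A} → F₁ (C.idC {A}) D.≈ D.idC
    homomorphism : ∀ {A B C′} {f : C.Hom A B} {g : C.Hom B C′} →
                   F₁ (g C.∘ f) D.≈ (F₁ g D.∘ F₁ f)
    F-resp-≈ : ∀ {A B} {f g : C.Hom A B} → f C.≈ g → F₁ f D.≈ F₁ g

module _ {o₁ h₁ o₂ h₂ : Level}
         {C : Category o₁ h₁} {D : Category o₂ h₂} where
  private
    module C = Category C
    module D = Category D
  open Functor

  record Adjunction (L : Functor C D) (R : Functor D C)
                    : Set (o₁ ⊔ h₁ ⊔ o₂ ⊔ h₂) where
    field
      η : ∀ A → C.Hom A (F₀ R (F₀ L A))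
      ε : ∀ B → D.Hom (F₀ L (F₀ R B)) B
      η-natural : ∀ {A A′} (f : C.Hom A A′) →
                  (F₁ R (F₁ L f) C.∘ η A) C.≈ (η A′ C.∘ f)
      ε-natural : ∀ {B B′} (g : D.Hom B B′) →
                  (g D.∘ ε B) D.≈ (ε B′ D.∘ F₁ L (F₁ R g))
      triangleˡ : ∀ A → (ε (F₀ L A) D.∘ F₁ L (η A)) D.≈ D.idC
      triangleʳ : ∀ B → (F₁ R (ε B) C.∘ η (F₀ R B)) C.≈ C.idC

  Faithful : Functor C D → Set (o₁ ⊔ h₁ ⊔ h₂)
  Faithful F = ∀ {A B} (f g : C.Hom A B) → F₁ F f D.≈ F₁ F g → f C.≈ g

  Full : Functor C D → Set (o₁ ⊔ h₁ ⊔ h₂)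
  Full F = ∀ {A B} (g : D.Hom (F₀ F A) (F₀ F B)) →
           Σ (C.Hom A B) (λ f → F₁ F f D.≈ g)

  FullyFaithful : Functor C D → Set (o₁ ⊔ h₁ ⊔ h₂)
  FullyFaithful F = Full F × Faithful F

  record NaturalIso (F G : Functor C D) : Set (o₁ ⊔ h₁ ⊔ h₂) where
    field
      α : ∀ A → D.Hom (F₀ F A) (F₀ G A)
      β : ∀ A → D.Hom (F₀ G A) (F₀ F A)
      α-natural : ∀ {A B} (f : C.Hom A B) →
                  (F₁ G f D.∘ α A) D.≈ (α B D.∘ F₁ F f)
      isoˡ : ∀ A → (β A D.∘ α A) D.≈ D.idC
      isoʳ : ∀ A → (α A D.∘ β A) D.≈ D.idC

idF : ∀ {o h} {C : Category o h} → Functor C C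
idF {C = C} = record
  { F₀ = λ A → A ; F₁ = λ f → f
  ; identity = ≈-refl ; homomorphism = ≈-refl ; F-resp-≈ = λ p → p }
  where open Category C

_∘F_ : ∀ {o₁ h₁ o₂ h₂ o₃ h₃}
         {C : Category o₁ h₁} {D : Category o₂ h₂} {E : Category o₃ h₃} →
       Functor D E → Functor C D → Functor C E
_∘F_ {E = E} G F = record
  { F₀ = λ A → G.F₀ (F.F₀ A)
  ; F₁ = λ f → G.F₁ (F.F₁ f)
  ; identity = E.≈-trans (G.F-resp-≈ F.identity) G.identity
  ; homomorphism = E.≈-trans (G.F-resp-≈ F.homomorphism) G.homomorphism
  ; F-resp-≈ = λ p → G.F-resp-≈ (F.F-resp-≈ p) }
  where
    module G = Functor G
    module F = Functor F
    module E = Category E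

record Equivalence {o₁ h₁ o₂ h₂ : Level}
                   (C : Category o₁ h₁) (D : Category o₂ h₂)
                   : Set (o₁ ⊔ h₁ ⊔ o₂ ⊔ h₂) where
  field
    to   : Functor C D
    from : Functor D C
    from∘to≅id : NaturalIso (from ∘F to) idF
    to∘from≅id : NaturalIso (to ∘F from) idF

module Universal {o h : Level} (C : Category o h) where
  open Category C

  IsTerminal : Obj → Set (o ⊔ h)
  IsTerminal T = ∀ X → Σ (Hom X T) (λ u → ∀ (v : Hom X T) → v ≈ u)

  IsPullback : ∀ {A B Z P} → Hom A Z → Hom B Z → Hom P A → Hom P B →
               Set (o ⊔ h)
  IsPullback {A} {B} {Z} {P} f g p q =
    (f ∘ p ≈ g ∘ q) ×
    (∀ X (a : Hom X A) (b : Hom X B) → f ∘ a ≈ g ∘ b →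
       Σ (Hom X P) (λ u → (p ∘ u ≈ a) × (q ∘ u ≈ b) ×
         (∀ (v : Hom X P) → p ∘ v ≈ a → q ∘ v ≈ b → v ≈ u)))

  IsProduct : ∀ {A B P} → Hom P A → Hom P B → Set (o ⊔ h)
  IsProduct {A} {B} {P} p q =
    ∀ X (a : Hom X A) (b : Hom X B) →
      Σ (Hom X P) (λ u → (p ∘ u ≈ a) × (q ∘ u ≈ b) ×
        (∀ (v : Hom X P) → p ∘ v ≈ a → q ∘ v ≈ b → v ≈ u))

  -- E is an exponential B^A, with product (P, p, q) of E and A and
  -- evaluation ev : P → B.
  IsExponential : ∀ {A B E P} → Hom P E → Hom P A → Hom P B → Set (o ⊔ h)
  IsExponential {A} {B} {E} {P} p q ev =
    IsProduct p q ×
    (∀ X {Y} (r : Hom Y X) (s : Hom Y A) → IsProduct r s →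
      ∀ (f : Hom Y B) →
        Σ (Hom X E) (λ g →
          (∀ (k : Hom Y P) → p ∘ k ≈ g ∘ r → q ∘ k ≈ s → ev ∘ k ≈ f) ×
          (∀ (g′ : Hom X E) →
             (∀ (k : Hom Y P) → p ∘ k ≈ g′ ∘ r → q ∘ k ≈ s → ev ∘ k ≈ f) →
             g′ ≈ g)))

  IsMono : ∀ {A B} → Hom A B → Set (o ⊔ h)
  IsMono {A} {B} m = ∀ {X} (f g : Hom X A) → m ∘ f ≈ m ∘ g → f ≈ g

  IsSubobjectClassifier : ∀ {T Ω} → Hom T Ω → Set (o ⊔ h)
  IsSubobjectClassifier {T} {Ω} true =
    IsTerminal T ×
    (∀ {A B} (m : Hom A B) → IsMono m → ∀ (! : Hom A T) →
      Σ (Hom B Ω) (λ χ → IsPullback χ true m ! ×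
        (∀ (χ′ : Hom B Ω) → IsPullback χ′ true m ! → χ′ ≈ χ)))

module _ {o₁ h₁ o₂ h₂ : Level}
         {C : Category o₁ h₁} {D : Category o₂ h₂} where
  private
    module C = Category C
    module D = Category D
    module UC = Universal C
    module UD = Universal D
  open Functor

  record IsLogical (F : Functor C D) : Set (o₁ ⊔ h₁ ⊔ o₂ ⊔ h₂) where
    field
      pres-terminal : ∀ T → UC.IsTerminal T → UD.IsTerminal (F₀ F T)
      pres-pullback : ∀ {A B Z P} (f : C.Hom A Z) (g : C.Hom B Z)
                        (p : C.Hom P A) (q : C.Hom P B) →
                      UC.IsPullback f g p q →
                      UD.IsPullback (F₁ F f) (F₁ F g) (F₁ F p) (F₁ F q)
      pres-exponential : ∀ {A B E P} (p : C.Hom P E) (q : C.Hom P A)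
                           (ev : C.Hom P B) →
                         UC.IsExponential p q ev →
                         UD.IsExponential (F₁ F p) (F₁ F q) (F₁ F ev)
      pres-subobject-classifier : ∀ {T Ω} (true : C.Hom T Ω) →
                         UC.IsSubobjectClassifier true →
                         UD.IsSubobjectClassifier (F₁ F true)

-- Essential geometric morphism E → F given by (L, F, F⋆) with
-- L ⊣ F ⊣ F⋆ and F : F → E the inverse image.
module _ {o₁ h₁ o₂ h₂ : Level}
         {ℱ : Category o₁ h₁} {ℰ : Category o₂ h₂} where

  IsEssentialGeometricMorphism :
    Functor ℰ ℱ → Functor ℱ ℰ → Functor ℰ ℱ → Set (o₁ ⊔ h₁ ⊔ o₂ ⊔ h₂)
  IsEssentialGeometricMorphism L F F⋆ = Adjunction L F × Adjunction F F⋆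

  IsAtomic : Functor ℰ ℱ → Functor ℱ ℰ → Functor ℰ ℱ → Set (o₁ ⊔ h₁ ⊔ o₂ ⊔ h₂)
  IsAtomic L F F⋆ = IsEssentialGeometricMorphism L F F⋆ × IsLogical F

  IsSurjection : Functor ℰ ℱ → Functor ℱ ℰ → Functor ℰ ℱ → Set (o₁ ⊔ h₁ ⊔ o₂ ⊔ h₂)
  IsSurjection L F F⋆ = IsEssentialGeometricMorphism L F F⋆ × Faithful F

  IsEmbedding : Functor ℰ ℱ → Functor ℱ ℰ → Functor ℰ ℱ → Set (o₁ ⊔ h₁ ⊔ o₂ ⊔ h₂)
  IsEmbedding L F F⋆ = IsEssentialGeometricMorphism L F F⋆ × FullyFaithful F⋆

  IsAtomicSurjection : Functor ℰ ℱ → Functor ℱ ℰ → Functor ℰ ℱ →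
                       Set (o₁ ⊔ h₁ ⊔ o₂ ⊔ h₂)
  IsAtomicSurjection L F F⋆ =
    IsEssentialGeometricMorphism L F F⋆ × IsLogical F × Faithful F

module _ {o h : Level} (C : Category o h) where
  open Category C

  record SliceObj (X : Obj) : Set (o ⊔ h) where
    constructor sliceObj
    field
      dom : Obj
      arr : Hom dom X

  record SliceHom {X : Obj} (A B : SliceObj X) : Set h where
    constructor sliceHom
    field
      hom : Hom (SliceObj.dom A) (SliceObj.dom B)
      commute : SliceObj.arr B ∘ hom ≈ SliceObj.arr A

  Slice : Obj → Category (o ⊔ h) h
  Slice X = record
    { Obj = SliceObj X
    ; Hom = SliceHom
    ; _≈_ = λ f g → SliceHom.hom f ≈ SliceHom.hom g
    ; idC = λ {A} → sliceHom idC identityʳ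
    ; _∘_ = λ {A} {B} {C′} f g → sliceHom (SliceHom.hom f ∘ SliceHom.hom g)
        (≈-trans (≈-sym assoc)
          (≈-trans (∘-resp-≈ (SliceHom.commute f) ≈-refl) (SliceHom.commute g)))
    ; ≈-refl = ≈-refl ; ≈-sym = ≈-sym ; ≈-trans = ≈-trans
    ; identityˡ = identityˡ ; identityʳ = identityʳ ; assoc = assoc
    ; ∘-resp-≈ = ∘-resp-≈ }

record Quiver (ℓ : Level) : Set (Level.suc ℓ) where
  constructor quiver
  field
    V : Set ℓ
    E : Set ℓ
    σ : E → V
    τ : E → V

record QuiverHom {ℓ} (Q R : Quiver ℓ) : Set ℓ where
  constructor quiverHom
  private
    module Q = Quiver Q
    module R = Quiver R
  field
    homV : Q.V → R.V
    homE : Q.E → R.E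
    comm-σ : ∀ e → R.σ (homE e) ≡ homV (Q.σ e)
    comm-τ : ∀ e → R.τ (homE e) ≡ homV (Q.τ e)

_≈Q_ : ∀ {ℓ} {Q R : Quiver ℓ} → QuiverHom Q R → QuiverHom Q R → Set ℓ
f ≈Q g = (∀ v → QuiverHom.homV f v ≡ QuiverHom.homV g v) ×
         (∀ e → QuiverHom.homE f e ≡ QuiverHom.homE g e)

idQ : ∀ {ℓ} {Q : Quiver ℓ} → QuiverHom Q Q
idQ = quiverHom id id (λ _ → refl) (λ _ → refl)

_∘Q_ : ∀ {ℓ} {A B C : Quiver ℓ} → QuiverHom B C → QuiverHom A B → QuiverHom A C
f ∘Q g = quiverHom (QuiverHom.homV f ∘′ QuiverHom.homV g)
                   (QuiverHom.homE f ∘′ QuiverHom.homE g)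
  (λ e → trans (QuiverHom.comm-σ f _) (cong (QuiverHom.homV f) (QuiverHom.comm-σ g e)))
  (λ e → trans (QuiverHom.comm-τ f _) (cong (QuiverHom.homV f) (QuiverHom.comm-τ g e)))

QuiverCat : (ℓ : Level) → Category (Level.suc ℓ) ℓ
QuiverCat ℓ = record
  { Obj = Quiver ℓ ; Hom = QuiverHom ; _≈_ = _≈Q_
  ; idC = idQ ; _∘_ = _∘Q_
  ; ≈-refl = (λ _ → refl) , (λ _ → refl)
  ; ≈-sym = λ p → (λ v → sym (proj₁ p v)) , (λ e → sym (proj₂ p e))
  ; ≈-trans = λ p q → (λ v → trans (proj₁ p v) (proj₁ q v))
                    , (λ e → trans (proj₂ p e) (proj₂ q e))
  ; identityˡ = (λ _ → refl) , (λ _ → refl)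
  ; identityʳ = (λ _ → refl) , (λ _ → refl)
  ; assoc = (λ _ → refl) , (λ _ → refl)
  ; ∘-resp-≈ = λ {f = f} {g′ = g′} p q →
      (λ v → trans (cong (QuiverHom.homV f) (proj₁ q v)) (proj₁ p _))
    , (λ e → trans (cong (QuiverHom.homE f) (proj₂ q e)) (proj₂ p _)) }

_×Q_ : ∀ {ℓ} → Quiver ℓ → Quiver ℓ → Quiver ℓ
Q ×Q R = quiver (Quiver.V Q × Quiver.V R) (Quiver.E Q × Quiver.E R)
  (λ { (a , b) → Quiver.σ Q a , Quiver.σ R b })
  (λ { (a , b) → Quiver.τ Q a , Quiver.τ R b })

⟨_,_⟩Q : ∀ {ℓ} {X Q R : Quiver ℓ} → QuiverHom X Q → QuiverHom X R →
         QuiverHom X (Q ×Q R)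
⟨ f , g ⟩Q = quiverHom (λ v → QuiverHom.homV f v , QuiverHom.homV g v)
                       (λ e → QuiverHom.homE f e , QuiverHom.homE g e)
  (λ e → cong₂′ (QuiverHom.comm-σ f e) (QuiverHom.comm-σ g e))
  (λ e → cong₂′ (QuiverHom.comm-τ f e) (QuiverHom.comm-τ g e))
  where
    cong₂′ : ∀ {a b} {A : Set a} {B : Set b} {x x′ : A} {y y′ : B} →
             x ≡ x′ → y ≡ y′ → (x , y) ≡ (x′ , y′)
    cong₂′ refl refl = refl

-- the quiver E⃗⋄({1}): two vertices, one edge from the first to the second
ArrowQuiver : (ℓ : Level) → Quiver ℓ
ArrowQuiver ℓ = quiver (⊤ {ℓ} ⊎ ⊤ {ℓ}) ⊤ (λ _ → inj₁ tt) (λ _ → inj₂ tt)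

record Hypergraph (ℓ : Level) : Set (Level.suc ℓ) where
  constructor hypergraph
  field
    V : Set ℓ
    E : Set ℓ
    I : Set ℓ
    ς : I → V
    ω : I → E

record HypergraphHom {ℓ} (G H : Hypergraph ℓ) : Set ℓ where
  constructor hypergraphHom
  private
    module G = Hypergraph G
    module H = Hypergraph H
  field
    homV : G.V → H.V
    homE : G.E → H.E
    homI : G.I → H.I
    comm-ς : ∀ i → H.ς (homI i) ≡ homV (G.ς i)
    comm-ω : ∀ i → H.ω (homI i) ≡ homE (G.ω i)

_≈H_ : ∀ {ℓ} {G H : Hypergraph ℓ} → HypergraphHom G H → HypergraphHom G H → Set ℓ
f ≈H g = (∀ v → HypergraphHom.homV f v ≡ HypergraphHom.homV g v) ×
         (∀ e → HypergraphHom.homE f e ≡ HypergraphHom.homE g e) ×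
         (∀ i → HypergraphHom.homI f i ≡ HypergraphHom.homI g i)

idH : ∀ {ℓ} {G : Hypergraph ℓ} → HypergraphHom G G
idH = hypergraphHom id id id (λ _ → refl) (λ _ → refl)

_∘H_ : ∀ {ℓ} {A B C : Hypergraph ℓ} →
       HypergraphHom B C → HypergraphHom A B → HypergraphHom A C
f ∘H g = hypergraphHom
  (HypergraphHom.homV f ∘′ HypergraphHom.homV g)
  (HypergraphHom.homE f ∘′ HypergraphHom.homE g)
  (HypergraphHom.homI f ∘′ HypergraphHom.homI g)
  (λ i → trans (HypergraphHom.comm-ς f _) (cong (HypergraphHom.homV f) (HypergraphHom.comm-ς g i)))
  (λ i → trans (HypergraphHom.comm-ω f _) (cong (HypergraphHom.homE f) (HypergraphHom.comm-ω g i)))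

HypergraphCat : (ℓ : Level) → Category (Level.suc ℓ) ℓ
HypergraphCat ℓ = record
  { Obj = Hypergraph ℓ ; Hom = HypergraphHom ; _≈_ = _≈H_
  ; idC = idH ; _∘_ = _∘H_
  ; ≈-refl = (λ _ → refl) , (λ _ → refl) , (λ _ → refl)
  ; ≈-sym = λ { (p , q , r) → (λ x → sym (p x)) , (λ x → sym (q x)) , (λ x → sym (r x)) }
  ; ≈-trans = λ { (p , q , r) (p′ , q′ , r′) →
      (λ x → trans (p x) (p′ x)) , (λ x → trans (q x) (q′ x)) , (λ x → trans (r x) (r′ x)) }
  ; identityˡ = (λ _ → refl) , (λ _ → refl) , (λ _ → refl)
  ; identityʳ = (λ _ → refl) , (λ _ → refl) , (λ _ → refl)
  ; assoc = (λ _ → refl) , (λ _ → refl) , (λ _ → refl)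
  ; ∘-resp-≈ = λ { {f = f} (p , q , r) (p′ , q′ , r′) →
      (λ x → trans (cong (HypergraphHom.homV f) (p′ x)) (p _))
    , (λ x → trans (cong (HypergraphHom.homE f) (q′ x)) (q _))
    , (λ x → trans (cong (HypergraphHom.homI f) (r′ x)) (r _)) } }

_×H_ : ∀ {ℓ} → Hypergraph ℓ → Hypergraph ℓ → Hypergraph ℓ
G ×H H = hypergraph (Hypergraph.V G × Hypergraph.V H)
                    (Hypergraph.E G × Hypergraph.E H)
                    (Hypergraph.I G × Hypergraph.I H)
  (λ { (a , b) → Hypergraph.ς G a , Hypergraph.ς H b })
  (λ { (a , b) → Hypergraph.ω G a , Hypergraph.ω H b })

π₁H : ∀ {ℓ} {G H : Hypergraph ℓ} → HypergraphHom (G ×H H) G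
π₁H = hypergraphHom proj₁ proj₁ proj₁ (λ _ → refl) (λ _ → refl)

π₂H : ∀ {ℓ} {G H : Hypergraph ℓ} → HypergraphHom (G ×H H) H
π₂H = hypergraphHom proj₂ proj₂ proj₂ (λ _ → refl) (λ _ → refl)

module _ {ℓ : Level} where

  Υ₀ : Quiver ℓ → Hypergraph ℓ
  Υ₀ Q = hypergraph (Quiver.V Q) (Quiver.V Q) (Quiver.E Q) (Quiver.σ Q) (Quiver.τ Q)

  Υ : Functor (QuiverCat ℓ) (HypergraphCat ℓ)
  Υ = record
    { F₀ = Υ₀
    ; F₁ = λ f → hypergraphHom (QuiverHom.homV f) (QuiverHom.homV f)
                   (QuiverHom.homE f) (QuiverHom.comm-σ f) (QuiverHom.comm-τ f)
    ; identity = (λ _ → refl) , (λ _ → refl) , (λ _ → refl)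
    ; homomorphism = (λ _ → refl) , (λ _ → refl) , (λ _ → refl)
    ; F-resp-≈ = λ { (p , q) → p , p , q } }

  -- vertices (1, v) are inj₁ v and (2, e) are inj₂ e
  Υ⋄₀ : Hypergraph ℓ → Quiver ℓ
  Υ⋄₀ G = quiver (Hypergraph.V G ⊎ Hypergraph.E G) (Hypergraph.I G)
                 (λ i → inj₁ (Hypergraph.ς G i)) (λ i → inj₂ (Hypergraph.ω G i))

  Υ⋄₁ : ∀ {G H : Hypergraph ℓ} → HypergraphHom G H → QuiverHom (Υ⋄₀ G) (Υ⋄₀ H)
  Υ⋄₁ f = quiverHom
    [ (λ v → inj₁ (HypergraphHom.homV f v)) , (λ e → inj₂ (HypergraphHom.homE f e)) ]′
    (HypergraphHom.homI f)
    (λ i → cong inj₁ (HypergraphHom.comm-ς f i))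
    (λ i → cong inj₂ (HypergraphHom.comm-ω f i))

  Υ⋄ : Functor (HypergraphCat ℓ) (QuiverCat ℓ)
  Υ⋄ = record
    { F₀ = Υ⋄₀
    ; F₁ = Υ⋄₁
    ; identity = (λ { (inj₁ _) → refl ; (inj₂ _) → refl }) , (λ _ → refl)
    ; homomorphism = (λ { (inj₁ _) → refl ; (inj₂ _) → refl }) , (λ _ → refl)
    ; F-resp-≈ = λ { (p , q , r) →
        (λ { (inj₁ v) → cong inj₁ (p v) ; (inj₂ e) → cong inj₂ (q e) }) , r } }

  Υ⋆₀ : Hypergraph ℓ → Quiver ℓ
  Υ⋆₀ G = quiver (Hypergraph.V G × Hypergraph.E G)
                 (Hypergraph.V G × Hypergraph.I G × Hypergraph.E G)
                 (λ { (v , i , e) → Hypergraph.ς G i , e })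
                 (λ { (v , i , e) → v , Hypergraph.ω G i })

  Υ⋆₁ : ∀ {G H : Hypergraph ℓ} → HypergraphHom G H → QuiverHom (Υ⋆₀ G) (Υ⋆₀ H)
  Υ⋆₁ f = quiverHom
    (λ { (v , e) → HypergraphHom.homV f v , HypergraphHom.homE f e })
    (λ { (v , i , e) → HypergraphHom.homV f v , HypergraphHom.homI f i
                       , HypergraphHom.homE f e })
    (λ { (v , i , e) → cong (λ x → x , HypergraphHom.homE f e) (HypergraphHom.comm-ς f i) })
    (λ { (v , i , e) → cong (λ x → HypergraphHom.homV f v , x) (HypergraphHom.comm-ω f i) })

  Υ⋆ : Functor (HypergraphCat ℓ) (QuiverCat ℓ)
  Υ⋆ = record
    { F₀ = Υ⋆₀
    ; F₁ = Υ⋆₁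
    ; identity = (λ _ → refl) , (λ _ → refl)
    ; homomorphism = (λ _ → refl) , (λ _ → refl)
    ; F-resp-≈ = λ { (p , q , r) →
        (λ { (v , e) → cong₂′ (p v) (q e) })
      , (λ { (v , i , e) → cong₂′ (p v) (cong₂′ (r i) (q e)) }) } }
    where
      cong₂′ : ∀ {a b} {A : Set a} {B : Set b} {x x′ : A} {y y′ : B} →
               x ≡ x′ → y ≡ y′ → (x , y) ≡ (x′ , y′)
      cong₂′ refl refl = refl

  counit : (Q : Quiver ℓ) → QuiverHom (Υ⋄₀ (Υ₀ Q)) Q
  counit Q = quiverHom [ id , id ]′ id (λ _ → refl) (λ _ → refl)

  frobenius : (Q : Quiver ℓ) (G : Hypergraph ℓ) →
              QuiverHom (Υ⋄₀ (Υ₀ Q ×H G)) (Q ×Q Υ⋄₀ G)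
  frobenius Q G = ⟨ counit Q ∘Q Υ⋄₁ (π₁H {G = Υ₀ Q} {H = G})
                  , Υ⋄₁ (π₂H {G = Υ₀ Q} {H = G}) ⟩Q

  frobeniusFormulaV : (Q : Quiver ℓ) (G : Hypergraph ℓ) →
                      Quiver.V (Υ⋄₀ (Υ₀ Q ×H G)) → Quiver.V (Q ×Q Υ⋄₀ G)
  frobeniusFormulaV Q G (inj₁ (v , x)) = v , inj₁ x
  frobeniusFormulaV Q G (inj₂ (v , x)) = v , inj₂ x

module Submission where

-- Transposition: a hypergraph map X → Υ(Q) and a quiver map Υ⋄(X) → Q
-- are the same data; the restriction ♯ preserves and reflects equality and
-- commutes with composition on the nose.  It gives Υ⋄ ⊣ Υ, and shows that
-- Υ preserves the terminal object, pullbacks and products.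
--
-- Decomposition: a quiver Z over Υ⋄(B) is Υ⋄ of a hypergraph (its parts)
-- over B, and side-preserving maps between Υ⋄'s are the maps Υ⋄(f).  For B
-- terminal this is the slice equivalence; for general B it shows that Υ⋄
-- preserves monos and satisfies Frobenius reciprocity, which transports
-- exponentials; with transposition it transports the subobject classifier.
-- Faithfulness of Υ and Υ⋄ is immediate, and Υ⋆ is not full, as seen on
-- a hypergraph with one edge and no vertices.

open import Defs
open import Level using (Level)
open import Data.Product using (Σ; _×_; _,_; proj₁; proj₂)
open import Data.Sum using (_⊎_; inj₁; inj₂; [_,_]′)
import Data.Sum as Sum
open import Data.Sum.Properties using (inj₁-injective; inj₂-injective)
open import Data.Unit using () renaming (⊤ to ⊤₀; tt to tt₀)
open import Data.Empty using () renaming (⊥ to ⊥₀)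
open import Data.Unit.Polymorphic using (⊤; tt)
open import Data.Empty.Polymorphic using (⊥; ⊥-elim)
open import Relation.Binary.Bundles using (Setoid)
import Relation.Binary.Reasoning.Setoid as SetoidReasoning
open import Relation.Binary.PropositionalEquality
  using (_≡_; refl; sym; trans; cong; cong₂; subst)
open import Relation.Nullary using (¬_)
open import Function using (_∘′_; id)

open QuiverHom renaming (homV to qV; homE to qE)
open HypergraphHom renaming (homV to hV; homE to hE; homI to hI)

module _ {o h : Level} (C : Category o h) where
  open Category C

  UniqueFactorisation : ∀ {X P A B} → Hom P A → Hom P B → Hom X A → Hom X B →
                        Set h
  UniqueFactorisation {X} {P} p q a b =
    Σ (Hom X P) (λ u → (p ∘ u ≈ a) × (q ∘ u ≈ b) ×
      (∀ (v : Hom X P) → p ∘ v ≈ a → q ∘ v ≈ b → v ≈ u))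

  -- g : X → E curries f : Y → B, where Y is a product X × A with
  -- projections r, s and P a product E × A with projections p, q and
  -- evaluation ev
  Curries : ∀ {A B E P X Y} → Hom P E → Hom P A → Hom P B →
            Hom Y X → Hom Y A → Hom Y B → Hom X E → Set h
  Curries {P = P} {Y = Y} p q ev r s f g =
    ∀ (k : Hom Y P) → p ∘ k ≈ g ∘ r → q ∘ k ≈ s → ev ∘ k ≈ f

-- The vertices of Υ⋄(G) form the sum V(G) ⊎ E(G); recognising on which
-- side a vertex lies is how quivers over Υ⋄(G) become hypergraphs.
module _ {a b} {A : Set a} {B : Set b} where

  IsLeft IsRight : A ⊎ B → Set
  IsLeft (inj₁ _) = ⊤₀
  IsLeft (inj₂ _) = ⊥₀
  IsRight (inj₁ _) = ⊥₀
  IsRight (inj₂ _) = ⊤₀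

  fromLeft : (w : A ⊎ B) → IsLeft w → A
  fromLeft (inj₁ x) _ = x
  fromLeft (inj₂ _) ()

  fromRight : (w : A ⊎ B) → IsRight w → B
  fromRight (inj₁ _) ()
  fromRight (inj₂ y) _ = y

  fromLeft-eq : (w : A ⊎ B) (p : IsLeft w) → inj₁ (fromLeft w p) ≡ w
  fromLeft-eq (inj₁ _) _ = refl
  fromLeft-eq (inj₂ _) ()

  fromRight-eq : (w : A ⊎ B) (p : IsRight w) → inj₂ (fromRight w p) ≡ w
  fromRight-eq (inj₁ _) ()
  fromRight-eq (inj₂ _) _ = refl

  side : (w : A ⊎ B) → IsLeft w ⊎ IsRight w
  side (inj₁ _) = inj₁ tt₀
  side (inj₂ _) = inj₂ tt₀

  side-left : (w : A ⊎ B) (p : IsLeft w) → side w ≡ inj₁ p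
  side-left (inj₁ _) _ = refl
  side-left (inj₂ _) ()

  side-right : (w : A ⊎ B) (p : IsRight w) → side w ≡ inj₂ p
  side-right (inj₁ _) ()
  side-right (inj₂ _) _ = refl

  IsLeft-irrelevant : (w : A ⊎ B) (p q : IsLeft w) → p ≡ q
  IsLeft-irrelevant (inj₁ _) _ _ = refl
  IsLeft-irrelevant (inj₂ _) ()

  IsRight-irrelevant : (w : A ⊎ B) (p q : IsRight w) → p ≡ q
  IsRight-irrelevant (inj₁ _) ()
  IsRight-irrelevant (inj₂ _) _ _ = refl

module _ {a b c} {X : Set a} {A : Set b} {B : Set c} (f : X → A ⊎ B) where

  left-point-≡ : ∀ {x y} {p : IsLeft (f x)} {q : IsLeft (f y)} → x ≡ y →
                 _≡_ {A = Σ X (λ z → IsLeft (f z))} (x , p) (y , q)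
  left-point-≡ {x} {p = p} {q} refl = cong (x ,_) (IsLeft-irrelevant (f x) p q)

  right-point-≡ : ∀ {x y} {p : IsRight (f x)} {q : IsRight (f y)} → x ≡ y →
                  _≡_ {A = Σ X (λ z → IsRight (f z))} (x , p) (y , q)
  right-point-≡ {x} {p = p} {q} refl = cong (x ,_) (IsRight-irrelevant (f x) p q)

module _ {ℓ : Level} where

  private
    module QC = Category (QuiverCat ℓ)
    module HC = Category (HypergraphCat ℓ)
    module UQ = Universal (QuiverCat ℓ)
    module UH = Universal (HypergraphCat ℓ)

  QuiverHoms : Quiver ℓ → Quiver ℓ → Setoid ℓ ℓ
  QuiverHoms Q R = record
    { Carrier = QuiverHom Q R ; _≈_ = _≈Q_
    ; isEquivalence = record
        { refl = λ {f} → QC.≈-refl {Q} {R} {f}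
        ; sym = λ {f} {g} → QC.≈-sym {Q} {R} {f} {g}
        ; trans = λ {f} {g} {k} → QC.≈-trans {Q} {R} {f} {g} {k} } }

  -- composition respects ≈Q on either side (the compared maps are implicit
  -- but usually have to be supplied: ≈Q unfolds to a pointwise statement
  -- from which they cannot be inferred)
  ∘-respˡ : ∀ {A B C : Quiver ℓ} (g : QuiverHom A B) {f f′ : QuiverHom B C} →
            f ≈Q f′ → (f ∘Q g) ≈Q (f′ ∘Q g)
  ∘-respˡ g (onV , onE) = (λ v → onV (qV g v)) , (λ e → onE (qE g e))

  ∘-respʳ : ∀ {A B C : Quiver ℓ} (f : QuiverHom B C) {g g′ : QuiverHom A B} →
            g ≈Q g′ → (f ∘Q g) ≈Q (f ∘Q g′)
  ∘-respʳ f (onV , onE) = (λ v → cong (qV f) (onV v)) , (λ e → cong (qE f) (onE e))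

  Υ₁ : ∀ {Q R : Quiver ℓ} → QuiverHom Q R → HypergraphHom (Υ₀ Q) (Υ₀ R)
  Υ₁ = Functor.F₁ Υ

  Υ⋄-triangle : ∀ {X Y Z : Hypergraph ℓ} (f : HypergraphHom Y Z)
                  (g : HypergraphHom X Y) {k : HypergraphHom X Z} →
                (f ∘H g) ≈H k → (Υ⋄₁ f ∘Q Υ⋄₁ g) ≈Q Υ⋄₁ k
  Υ⋄-triangle f g (onV , onE , onI) =
    (λ { (inj₁ v) → cong inj₁ (onV v) ; (inj₂ e) → cong inj₂ (onE e) }) , onI

  ♭ : ∀ {X : Hypergraph ℓ} {Q : Quiver ℓ} →
      HypergraphHom X (Υ₀ Q) → QuiverHom (Υ⋄₀ X) Q
  ♭ f = quiverHom [ hV f , hE f ]′ (hI f) (comm-ς f) (comm-ω f)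

  -- restriction along the vertices and edges of X; definitionally
  -- ♯ (♭ f) = f, ♯ (h ∘ u) = Υ(h) ∘ ♯ u and ♯ (u ∘ Υ⋄(a)) = ♯ u ∘ a
  ♯ : ∀ {X : Hypergraph ℓ} {Q : Quiver ℓ} →
      QuiverHom (Υ⋄₀ X) Q → HypergraphHom X (Υ₀ Q)
  ♯ u = hypergraphHom (qV u ∘′ inj₁) (qV u ∘′ inj₂) (qE u) (comm-σ u) (comm-τ u)

  ♯-resp-≈ : ∀ {X Q} (u u′ : QuiverHom (Υ⋄₀ X) Q) → u ≈Q u′ → ♯ u ≈H ♯ u′
  ♯-resp-≈ u u′ (onV , onE) = (λ v → onV (inj₁ v)) , (λ e → onV (inj₂ e)) , onE

  ♯-reflects-≈ : ∀ {X Q} (u u′ : QuiverHom (Υ⋄₀ X) Q) → ♯ u ≈H ♯ u′ → u ≈Q u′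
  ♯-reflects-≈ u u′ (onV , onE , onI) =
    (λ { (inj₁ v) → onV v ; (inj₂ e) → onE e }) , onI

  Υ⋄⊣Υ : Adjunction (Υ⋄ {ℓ}) (Υ {ℓ})
  Υ⋄⊣Υ = record
    { η = λ G → hypergraphHom inj₁ inj₂ id (λ _ → refl) (λ _ → refl)
    ; ε = counit
    ; η-natural = λ f → (λ _ → refl) , (λ _ → refl) , (λ _ → refl)
    ; ε-natural = λ g → (λ { (inj₁ _) → refl ; (inj₂ _) → refl }) , (λ _ → refl)
    ; triangleˡ = λ A → (λ { (inj₁ _) → refl ; (inj₂ _) → refl }) , (λ _ → refl)
    ; triangleʳ = λ B → (λ _ → refl) , (λ _ → refl) , (λ _ → refl) }

  Υ⊣Υ⋆ : Adjunction (Υ {ℓ}) (Υ⋆ {ℓ})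
  Υ⊣Υ⋆ = record
    { η = λ Q → quiverHom (λ v → v , v) (λ e → Quiver.τ Q e , e , Quiver.σ Q e)
                          (λ _ → refl) (λ _ → refl)
    ; ε = λ G → hypergraphHom proj₁ proj₂ (λ t → proj₁ (proj₂ t))
                              (λ _ → refl) (λ _ → refl)
    ; η-natural = λ f →
        (λ _ → refl) ,
        (λ e → cong₂ _,_ (sym (comm-τ f e)) (cong₂ _,_ refl (sym (comm-σ f e))))
    ; ε-natural = λ g → (λ _ → refl) , (λ _ → refl) , (λ _ → refl)
    ; triangleˡ = λ A → (λ _ → refl) , (λ _ → refl) , (λ _ → refl)
    ; triangleʳ = λ B → (λ _ → refl) , (λ _ → refl) }

  -- Υ(f) and Υ⋄(f) retain every component of f
  Υ-faithful : Faithful (Υ {ℓ})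
  Υ-faithful f g (onV , _ , onI) = onV , onI

  Υ⋄-faithful : Faithful (Υ⋄ {ℓ})
  Υ⋄-faithful f g (onV , onE) =
    (λ v → inj₁-injective (onV (inj₁ v))) , (λ e → inj₂-injective (onV (inj₂ e))) , onE

  -- Υ⋆(G) has vertex set V(G) × E(G), so a hypergraph with one edge and
  -- no vertices and the empty hypergraph both go to the empty quiver,
  -- although there is no hypergraph map from the first to the second.
  Υ⋆-not-full : ¬ Full (Υ⋆ {ℓ})
  Υ⋆-not-full full = ⊥-elim (hE (proj₁ (full {loneEdge} {empty} fromEmpty)) tt)
    where
      loneEdge empty : Hypergraph ℓ
      loneEdge = hypergraph ⊥ ⊤ ⊥ ⊥-elim ⊥-elim
      empty = hypergraph ⊥ ⊥ ⊥ ⊥-elim ⊥-elim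
      fromEmpty : QuiverHom (Υ⋆₀ loneEdge) (Υ⋆₀ empty)
      fromEmpty = quiverHom (λ t → ⊥-elim (proj₁ t)) (λ t → ⊥-elim (proj₁ t))
                            (λ t → ⊥-elim (proj₁ t)) (λ t → ⊥-elim (proj₁ t))

  Υ-not-embedding : ¬ IsEmbedding (Υ⋄ {ℓ}) (Υ {ℓ}) (Υ⋆ {ℓ})
  Υ-not-embedding (_ , full , _) = Υ⋆-not-full full

  PreservesSides : ∀ {X Y : Hypergraph ℓ} → QuiverHom (Υ⋄₀ X) (Υ⋄₀ Y) → Set ℓ
  PreservesSides u = (∀ v → IsLeft (qV u (inj₁ v))) × (∀ e → IsRight (qV u (inj₂ e)))

  descend : ∀ {X Y : Hypergraph ℓ} (u : QuiverHom (Υ⋄₀ X) (Υ⋄₀ Y)) →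
            PreservesSides u → Σ (HypergraphHom X Y) (λ f → Υ⋄₁ f ≈Q u)
  descend u (left , right) =
    f , (λ { (inj₁ v) → fromLeft-eq _ (left v) ; (inj₂ e) → fromRight-eq _ (right e) }) ,
        (λ _ → refl)
    where
      f = hypergraphHom (λ v → fromLeft (qV u (inj₁ v)) (left v))
                        (λ e → fromRight (qV u (inj₂ e)) (right e)) (qE u)
            (λ i → inj₁-injective (trans (comm-σ u i) (sym (fromLeft-eq _ (left _)))))
            (λ i → inj₂-injective (trans (comm-τ u i) (sym (fromRight-eq _ (right _)))))

  sides-reflected : ∀ {X A B : Hypergraph ℓ} (m : HypergraphHom A B)
                      (a : HypergraphHom X B) (u : QuiverHom (Υ⋄₀ X) (Υ⋄₀ A)) →
                    (Υ⋄₁ m ∘Q u) ≈Q Υ⋄₁ a → PreservesSides u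
  sides-reflected m a u (onV , _) =
    (λ v → left-of (qV u (inj₁ v)) (onV (inj₁ v))) ,
    (λ e → right-of (qV u (inj₂ e)) (onV (inj₂ e)))
    where
      left-of : ∀ w {x} → qV (Υ⋄₁ m) w ≡ inj₁ x → IsLeft w
      left-of (inj₁ _) _ = tt₀
      left-of (inj₂ _) ()
      right-of : ∀ w {x} → qV (Υ⋄₁ m) w ≡ inj₂ x → IsRight w
      right-of (inj₁ _) ()
      right-of (inj₂ _) _ = tt₀

  record Descent {X A B : Hypergraph ℓ} (m : HypergraphHom A B) (a : HypergraphHom X B)
                 (u : QuiverHom (Υ⋄₀ X) (Υ⋄₀ A)) : Set ℓ where
    field
      lift : HypergraphHom X A
      Υ⋄-lift : Υ⋄₁ lift ≈Q u
      lift-over : (m ∘H lift) ≈H a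

  descend-through : ∀ {X A B : Hypergraph ℓ} (m : HypergraphHom A B)
                      (a : HypergraphHom X B) (u : QuiverHom (Υ⋄₀ X) (Υ⋄₀ A)) →
                    (Υ⋄₁ m ∘Q u) ≈Q Υ⋄₁ a → Descent m a u
  descend-through {X} {A} {B} m a u lifts = record
    { lift = u₀
    ; Υ⋄-lift = Υ⋄u₀≈u
    ; lift-over = Υ⋄-faithful (m ∘H u₀) a (begin
        Υ⋄₁ (m ∘H u₀)    ≈⟨ Υ⋄-triangle m u₀ {m ∘H u₀}
                               ((λ _ → refl) , (λ _ → refl) , (λ _ → refl)) ⟨
        Υ⋄₁ m ∘Q Υ⋄₁ u₀  ≈⟨ ∘-respʳ (Υ⋄₁ m) {Υ⋄₁ u₀} {u} Υ⋄u₀≈u ⟩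
        Υ⋄₁ m ∘Q u       ≈⟨ lifts ⟩
        Υ⋄₁ a            ∎) }
    where
      open SetoidReasoning (QuiverHoms (Υ⋄₀ X) (Υ⋄₀ B))
      sides : PreservesSides u
      sides = sides-reflected m a u lifts
      u₀ : HypergraphHom X A
      u₀ = proj₁ (descend u sides)
      Υ⋄u₀≈u : Υ⋄₁ u₀ ≈Q u
      Υ⋄u₀≈u = proj₂ (descend u sides)

  -- A quiver Z over Υ⋄(B) is Υ⋄ of its parts: the vertices of Z over
  -- vertices of B and those over edges of B, with the edges of Z as
  -- incidences.
  module Decomposition {Z : Quiver ℓ} {B : Hypergraph ℓ} (a : QuiverHom Z (Υ⋄₀ B)) where
    private module Z = Quiver Z

    source-left : ∀ e → IsLeft (qV a (Z.σ e))
    source-left e = subst IsLeft (comm-σ a e) tt₀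

    target-right : ∀ e → IsRight (qV a (Z.τ e))
    target-right e = subst IsRight (comm-τ a e) tt₀

    parts : Hypergraph ℓ
    parts = hypergraph (Σ Z.V (λ z → IsLeft (qV a z))) (Σ Z.V (λ z → IsRight (qV a z)))
                       Z.E (λ e → Z.σ e , source-left e) (λ e → Z.τ e , target-right e)

    unpack : QuiverHom (Υ⋄₀ parts) Z
    unpack = quiverHom [ proj₁ , proj₁ ]′ id (λ _ → refl) (λ _ → refl)

    pack : QuiverHom Z (Υ⋄₀ parts)
    pack = quiverHom (λ z → Sum.map (z ,_) (z ,_) (side (qV a z))) id
      (λ e → cong (Sum.map _ _) (sym (side-left _ (source-left e))))
      (λ e → cong (Sum.map _ _) (sym (side-right _ (target-right e))))

    unpack∘pack : (unpack ∘Q pack) ≈Q idQ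
    unpack∘pack = (λ z → forget-side z (side (qV a z))) , (λ _ → refl)
      where
        forget-side : ∀ z (s : IsLeft (qV a z) ⊎ IsRight (qV a z)) →
                      qV unpack (Sum.map (z ,_) (z ,_) s) ≡ z
        forget-side _ (inj₁ _) = refl
        forget-side _ (inj₂ _) = refl

    pack∘unpack : (pack ∘Q unpack) ≈Q idQ
    pack∘unpack =
      (λ { (inj₁ (z , p)) → cong (Sum.map (z ,_) (z ,_)) (side-left _ p)
         ; (inj₂ (z , p)) → cong (Sum.map (z ,_) (z ,_)) (side-right _ p) }) ,
      (λ _ → refl)

    -- unpack is split epi, so it can be cancelled on the right
    unpack-cancel : ∀ {R : Quiver ℓ} (f g : QuiverHom Z R) →
                    (f ∘Q unpack) ≈Q (g ∘Q unpack) → f ≈Q g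
    unpack-cancel {R} f g f≈g = begin
      f                      ≈⟨ ∘-respʳ f {unpack ∘Q pack} {idQ} unpack∘pack ⟨
      (f ∘Q unpack) ∘Q pack  ≈⟨ ∘-respˡ pack {f ∘Q unpack} {g ∘Q unpack} f≈g ⟩
      (g ∘Q unpack) ∘Q pack  ≈⟨ ∘-respʳ g {unpack ∘Q pack} {idQ} unpack∘pack ⟩
      g                      ∎
      where open SetoidReasoning (QuiverHoms Z R)

    label : HypergraphHom parts B
    label = hypergraphHom (λ { (z , p) → fromLeft (qV a z) p })
                          (λ { (z , p) → fromRight (qV a z) p }) (qE a)
      (λ i → inj₁-injective (trans (comm-σ a i) (sym (fromLeft-eq _ _))))
      (λ i → inj₂-injective (trans (comm-τ a i) (sym (fromRight-eq _ _))))

    label-spec : Υ⋄₁ label ≈Q (a ∘Q unpack)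
    label-spec = (λ { (inj₁ (z , p)) → fromLeft-eq _ p ; (inj₂ (z , p)) → fromRight-eq _ p })
               , (λ _ → refl)

    label-factor : (Υ⋄₁ label ∘Q pack) ≈Q a
    label-factor = begin
      Υ⋄₁ label ∘Q pack      ≈⟨ ∘-respˡ pack {Υ⋄₁ label} {a ∘Q unpack} label-spec ⟩
      (a ∘Q unpack) ∘Q pack  ≈⟨ ∘-respʳ a {unpack ∘Q pack} {idQ} unpack∘pack ⟩
      a                      ∎
      where open SetoidReasoning (QuiverHoms Z (Υ⋄₀ B))

    extension-over : ∀ {Y} (r : HypergraphHom Y B) (u₀ : HypergraphHom parts Y) →
                     (r ∘H u₀) ≈H label → (Υ⋄₁ r ∘Q (Υ⋄₁ u₀ ∘Q pack)) ≈Q a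
    extension-over {Y} r u₀ r∘u₀≈label = begin
      (Υ⋄₁ r ∘Q Υ⋄₁ u₀) ∘Q pack  ≈⟨ ∘-respˡ pack {Υ⋄₁ r ∘Q Υ⋄₁ u₀} {Υ⋄₁ label}
                                     (Υ⋄-triangle r u₀ {label} r∘u₀≈label) ⟩
      Υ⋄₁ label ∘Q pack          ≈⟨ label-factor ⟩
      a                          ∎
      where open SetoidReasoning (QuiverHoms Z (Υ⋄₀ B))

    extension-transposes : ∀ {Y A} (s : HypergraphHom Y (Υ₀ A)) (u₀ : HypergraphHom parts Y)
                             (b : QuiverHom Z A) →
                           (s ∘H u₀) ≈H ♯ (b ∘Q unpack) → (♭ s ∘Q (Υ⋄₁ u₀ ∘Q pack)) ≈Q b
    extension-transposes {A = A} s u₀ b s∘u₀≈b′ = begin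
      (♭ s ∘Q Υ⋄₁ u₀) ∘Q pack  ≈⟨ ∘-respˡ pack {♭ s ∘Q Υ⋄₁ u₀} {b ∘Q unpack}
                                   (♯-reflects-≈ (♭ s ∘Q Υ⋄₁ u₀) (b ∘Q unpack) s∘u₀≈b′) ⟩
      (b ∘Q unpack) ∘Q pack    ≈⟨ ∘-respʳ b {unpack ∘Q pack} {idQ} unpack∘pack ⟩
      b                        ∎
      where open SetoidReasoning (QuiverHoms Z A)

  -- Υ⋄ preserves monomorphisms: decompose the common source of f and g
  -- along f; then g ∘ unpack lifts through m as well, and m being mono
  -- identifies the two lifts.
  Υ⋄-preserves-mono : ∀ {A B : Hypergraph ℓ} (m : HypergraphHom A B) →
                      UH.IsMono m → UQ.IsMono (Υ⋄₁ m)
  Υ⋄-preserves-mono {A} {B} m mono f g m∘f≈m∘g = unpack-cancel f g f∘unpack≈g∘unpack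
    where
      open Decomposition f

      g-lifts : (Υ⋄₁ m ∘Q (g ∘Q unpack)) ≈Q Υ⋄₁ (m ∘H label)
      g-lifts = begin
        Υ⋄₁ m ∘Q (g ∘Q unpack)  ≈⟨ ∘-respˡ unpack {Υ⋄₁ m ∘Q f} {Υ⋄₁ m ∘Q g} m∘f≈m∘g ⟨
        Υ⋄₁ m ∘Q (f ∘Q unpack)  ≈⟨ ∘-respʳ (Υ⋄₁ m) {Υ⋄₁ label} {f ∘Q unpack} label-spec ⟨
        Υ⋄₁ m ∘Q Υ⋄₁ label      ≈⟨ Υ⋄-triangle m label {m ∘H label}
                                      ((λ _ → refl) , (λ _ → refl) , (λ _ → refl)) ⟩
        Υ⋄₁ (m ∘H label)        ∎
        where open SetoidReasoning (QuiverHoms (Υ⋄₀ parts) (Υ⋄₀ B))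

      open Descent (descend-through m (m ∘H label) (g ∘Q unpack) g-lifts)
        renaming (lift to g₀; Υ⋄-lift to Υ⋄g₀≈g∘unpack; lift-over to m∘g₀≈m∘label)

      f∘unpack≈g∘unpack : (f ∘Q unpack) ≈Q (g ∘Q unpack)
      f∘unpack≈g∘unpack = begin
        f ∘Q unpack   ≈⟨ label-spec ⟨
        Υ⋄₁ label     ≈⟨ Functor.F-resp-≈ Υ⋄ {f = g₀} {g = label}
                             (mono g₀ label m∘g₀≈m∘label) ⟨
        Υ⋄₁ g₀        ≈⟨ Υ⋄g₀≈g∘unpack ⟩
        g ∘Q unpack   ∎
        where open SetoidReasoning (QuiverHoms (Υ⋄₀ parts) (Υ⋄₀ A))

  -- A cone (a, b) from Z is answered by decomposing Z
  -- along a.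
  frobenius-reciprocity : ∀ {X Y : Hypergraph ℓ} {A : Quiver ℓ}
                            (r : HypergraphHom Y X) (s : HypergraphHom Y (Υ₀ A)) →
                          UH.IsProduct r s → UQ.IsProduct (Υ⋄₁ r) (♭ s)
  frobenius-reciprocity {X} {Y} {A} r s product Z a b = extend (product parts label b′)
    where
      open Decomposition a

      b′ : HypergraphHom parts (Υ₀ A)
      b′ = ♯ (b ∘Q unpack)

      extend : UniqueFactorisation (HypergraphCat ℓ) r s label b′ →
               UniqueFactorisation (QuiverCat ℓ) (Υ⋄₁ r) (♭ s) a b
      extend (u₀ , r∘u₀≈label , s∘u₀≈b′ , u₀-unique) =
        u , extension-over r u₀ r∘u₀≈label , extension-transposes s u₀ b s∘u₀≈b′ , unique
        where
          u : QuiverHom Z (Υ⋄₀ Y)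
          u = Υ⋄₁ u₀ ∘Q pack

          -- a competitor v restricted to the parts descends, and is u₀ there
          unique : ∀ (v : QuiverHom Z (Υ⋄₀ Y)) →
                   (Υ⋄₁ r ∘Q v) ≈Q a → (♭ s ∘Q v) ≈Q b → v ≈Q u
          unique v r∘v≈a s∘v≈b = unpack-cancel v u v∘unpack≈u∘unpack
            where
              v-lifts : (Υ⋄₁ r ∘Q (v ∘Q unpack)) ≈Q Υ⋄₁ label
              v-lifts = begin
                (Υ⋄₁ r ∘Q v) ∘Q unpack  ≈⟨ ∘-respˡ unpack {Υ⋄₁ r ∘Q v} {a} r∘v≈a ⟩
                a ∘Q unpack             ≈⟨ label-spec ⟨
                Υ⋄₁ label               ∎
                where open SetoidReasoning (QuiverHoms (Υ⋄₀ parts) (Υ⋄₀ X))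

              open Descent (descend-through r label (v ∘Q unpack) v-lifts)
                renaming (lift to v₀; Υ⋄-lift to Υ⋄v₀≈v∘unpack; lift-over to r∘v₀≈label)

              s∘v₀≈b′ : (s ∘H v₀) ≈H b′
              s∘v₀≈b′ = ♯-resp-≈ (♭ s ∘Q Υ⋄₁ v₀) (b ∘Q unpack) (begin
                ♭ s ∘Q Υ⋄₁ v₀         ≈⟨ ∘-respʳ (♭ s) {Υ⋄₁ v₀} {v ∘Q unpack} Υ⋄v₀≈v∘unpack ⟩
                (♭ s ∘Q v) ∘Q unpack  ≈⟨ ∘-respˡ unpack {♭ s ∘Q v} {b} s∘v≈b ⟩
                b ∘Q unpack           ∎)
                where open SetoidReasoning (QuiverHoms (Υ⋄₀ parts) A)

              v∘unpack≈u∘unpack : (v ∘Q unpack) ≈Q (u ∘Q unpack)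
              v∘unpack≈u∘unpack = begin
                v ∘Q unpack  ≈⟨ Υ⋄v₀≈v∘unpack ⟨
                Υ⋄₁ v₀       ≈⟨ Functor.F-resp-≈ Υ⋄ {f = v₀} {g = u₀}
                                  (u₀-unique v₀ r∘v₀≈label s∘v₀≈b′) ⟩
                Υ⋄₁ u₀       ≈⟨ ∘-respʳ (Υ⋄₁ u₀) {pack ∘Q unpack} {idQ} pack∘unpack ⟨
                u ∘Q unpack  ∎
                where open SetoidReasoning (QuiverHoms (Υ⋄₀ parts) (Υ⋄₀ Y))

  -- the Frobenius morphism Υ⋄(Υ(Q) × G) → Q × Υ⋄(G), the comparison map
  -- of the reciprocity above up to the order of the factors, is
  -- (n, v, x) ↦ (v, n, x) on vertices and the identity on edges
  frobenius-vertices : (Q : Quiver ℓ) (G : Hypergraph ℓ) →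
                       ∀ w → qV (frobenius Q G) w ≡ frobeniusFormulaV Q G w
  frobenius-vertices Q G (inj₁ _) = refl
  frobenius-vertices Q G (inj₂ _) = refl

  -- the terminal hypergraph; Υ⋄ of it is (definitionally) the arrow quiver
  point : Hypergraph ℓ
  point = hypergraph ⊤ ⊤ ⊤ (λ _ → tt) (λ _ → tt)

  toPoint : (G : Hypergraph ℓ) → HypergraphHom G point
  toPoint G = hypergraphHom (λ _ → tt) (λ _ → tt) (λ _ → tt) (λ _ → refl) (λ _ → refl)

  QuiversOverArrow : Category (Level.suc ℓ) ℓ
  QuiversOverArrow = Slice (QuiverCat ℓ) (ArrowQuiver ℓ)

  overArrow : Functor (HypergraphCat ℓ) QuiversOverArrow
  overArrow = record
    { F₀ = λ G → record { dom = Υ⋄₀ G ; arr = Υ⋄₁ (toPoint G) }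
    ; F₁ = λ {G} {H} f → record
        { hom = Υ⋄₁ f
        ; commute = Υ⋄-triangle (toPoint H) f {toPoint G}
                      ((λ _ → refl) , (λ _ → refl) , (λ _ → refl)) }
    ; identity = λ {G} → Functor.identity Υ⋄ {G}
    ; homomorphism = λ {f = f} {g} → Functor.homomorphism Υ⋄ {f = f} {g = g}
    ; F-resp-≈ = λ {f = f} {g} → Functor.F-resp-≈ Υ⋄ {f = f} {g = g} }

  -- a quiver over the arrow is bipartite, and decomposes over point
  module OverArrow (X : SliceObj (QuiverCat ℓ) (ArrowQuiver ℓ)) =
    Decomposition {B = point} (SliceObj.arr X)

  -- a map of quivers over the arrow keeps sides, so restricts to parts
  partsMap : ∀ {X Y} → SliceHom (QuiverCat ℓ) X Y →
             HypergraphHom (OverArrow.parts X) (OverArrow.parts Y)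
  partsMap {X} {Y} h = hypergraphHom
    (λ { (z , p) → qV hom z , subst IsLeft (sym (proj₁ commute z)) p })
    (λ { (z , p) → qV hom z , subst IsRight (sym (proj₁ commute z)) p })
    (qE hom)
    (λ i → left-point-≡ (qV (SliceObj.arr Y)) (comm-σ hom i))
    (λ i → right-point-≡ (qV (SliceObj.arr Y)) (comm-τ hom i))
    where open SliceHom h

  fromOverArrow : Functor QuiversOverArrow (HypergraphCat ℓ)
  fromOverArrow = record
    { F₀ = OverArrow.parts
    ; F₁ = partsMap
    ; identity = λ {X} →
        (λ _ → left-point-≡ (qV (SliceObj.arr X)) refl) ,
        (λ _ → right-point-≡ (qV (SliceObj.arr X)) refl) , (λ _ → refl)
    ; homomorphism = λ {_} {_} {X} →
        (λ _ → left-point-≡ (qV (SliceObj.arr X)) refl) ,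
        (λ _ → right-point-≡ (qV (SliceObj.arr X)) refl) , (λ _ → refl)
    ; F-resp-≈ = λ {_} {Y} h≈h′ →
        (λ { (z , _) → left-point-≡ (qV (SliceObj.arr Y)) (proj₁ h≈h′ z) }) ,
        (λ { (z , _) → right-point-≡ (qV (SliceObj.arr Y)) (proj₁ h≈h′ z) }) ,
        proj₂ h≈h′ }

  parts-of-Υ⋄ : NaturalIso (fromOverArrow ∘F overArrow) idF
  parts-of-Υ⋄ = record
    { α = λ G → hypergraphHom (λ { (inj₁ v , _) → v ; (inj₂ _ , ()) })
                              (λ { (inj₁ _ , ()) ; (inj₂ e , _) → e }) id (λ _ → refl) (λ _ → refl)
    ; β = λ G → hypergraphHom (λ v → inj₁ v , tt₀) (λ e → inj₂ e , tt₀)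
                              id (λ _ → refl) (λ _ → refl)
    ; α-natural = λ f →
        (λ { (inj₁ _ , _) → refl ; (inj₂ _ , ()) }) ,
        (λ { (inj₁ _ , ()) ; (inj₂ _ , _) → refl }) , (λ _ → refl)
    ; isoˡ = λ G →
        (λ { (inj₁ _ , _) → refl ; (inj₂ _ , ()) }) ,
        (λ { (inj₁ _ , ()) ; (inj₂ _ , _) → refl }) , (λ _ → refl)
    ; isoʳ = λ G → (λ _ → refl) , (λ _ → refl) , (λ _ → refl) }

  Υ⋄-of-parts : NaturalIso (overArrow ∘F fromOverArrow) idF
  Υ⋄-of-parts = record
    { α = λ X → record
        { hom = OverArrow.unpack X
        ; commute = QC.≈-sym {f = Υ⋄₁ (OverArrow.label X)}
                             {g = SliceObj.arr X ∘Q OverArrow.unpack X}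
                             (OverArrow.label-spec X) }
    ; β = λ X → record { hom = OverArrow.pack X ; commute = OverArrow.label-factor X }
    ; α-natural = λ h → (λ { (inj₁ _) → refl ; (inj₂ _) → refl }) , (λ _ → refl)
    ; isoˡ = OverArrow.pack∘unpack
    ; isoʳ = OverArrow.unpack∘pack }

  hypergraphs≃quiversOverArrow : Equivalence (HypergraphCat ℓ) QuiversOverArrow
  hypergraphs≃quiversOverArrow = record
    { to = overArrow ; from = fromOverArrow
    ; from∘to≅id = parts-of-Υ⋄ ; to∘from≅id = Υ⋄-of-parts }

  transpose-factorisation :
    ∀ {X : Hypergraph ℓ} {P A B : Quiver ℓ} (p : QuiverHom P A) (q : QuiverHom P B)
      {a : HypergraphHom X (Υ₀ A)} {b : HypergraphHom X (Υ₀ B)} →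
    UniqueFactorisation (QuiverCat ℓ) p q (♭ a) (♭ b) →
    UniqueFactorisation (HypergraphCat ℓ) (Υ₁ p) (Υ₁ q) a b
  transpose-factorisation p q {a} {b} (u , p∘u≈a , q∘u≈b , unique) =
    ♯ u , ♯-resp-≈ (p ∘Q u) (♭ a) p∘u≈a , ♯-resp-≈ (q ∘Q u) (♭ b) q∘u≈b ,
    λ v p∘v≈a q∘v≈b → ♯-resp-≈ (♭ v) u
      (unique (♭ v) (♯-reflects-≈ (p ∘Q ♭ v) (♭ a) p∘v≈a)
                    (♯-reflects-≈ (q ∘Q ♭ v) (♭ b) q∘v≈b))

  -- as a right adjoint Υ preserves the terminal object, pullbacks and
  -- products: each universal property is transposed
  Υ-preserves-terminal : ∀ T → UQ.IsTerminal T → UH.IsTerminal (Υ₀ T)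
  Υ-preserves-terminal T terminal X =
    ♯ (proj₁ (terminal (Υ⋄₀ X))) ,
    λ v → ♯-resp-≈ (♭ v) (proj₁ (terminal (Υ⋄₀ X))) (proj₂ (terminal (Υ⋄₀ X)) (♭ v))

  Υ-preserves-pullback : ∀ {A B Z P} (f : QuiverHom A Z) (g : QuiverHom B Z)
                           (p : QuiverHom P A) (q : QuiverHom P B) →
                         UQ.IsPullback f g p q → UH.IsPullback (Υ₁ f) (Υ₁ g) (Υ₁ p) (Υ₁ q)
  Υ-preserves-pullback f g p q (square , universal) =
    Functor.F-resp-≈ Υ {f = f ∘Q p} {g = g ∘Q q} square ,
    λ X a b commutes → transpose-factorisation p q {a} {b}
      (universal (Υ⋄₀ X) (♭ a) (♭ b) (♯-reflects-≈ (f ∘Q ♭ a) (g ∘Q ♭ b) commutes))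

  Υ-preserves-product : ∀ {A B P} (p : QuiverHom P A) (q : QuiverHom P B) →
                        UQ.IsProduct p q → UH.IsProduct (Υ₁ p) (Υ₁ q)
  Υ-preserves-product p q universal X a b =
    transpose-factorisation p q {a} {b} (universal (Υ⋄₀ X) (♭ a) (♭ b))

  -- Currying transposes in both directions, because by Frobenius
  -- reciprocity maps out of a product X × Υ(A) are maps out of
  -- Υ⋄(X) × A.
  transpose-currying :
    ∀ {A B E P : Quiver ℓ} {X Y : Hypergraph ℓ}
      (p : QuiverHom P E) (q : QuiverHom P A) (ev : QuiverHom P B)
      (r : HypergraphHom Y X) (s : HypergraphHom Y (Υ₀ A)) (f : HypergraphHom Y (Υ₀ B))
      (g : QuiverHom (Υ⋄₀ X) E) →
    Curries (QuiverCat ℓ) p q ev (Υ⋄₁ r) (♭ s) (♭ f) g →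
    Curries (HypergraphCat ℓ) (Υ₁ p) (Υ₁ q) (Υ₁ ev) r s f (♯ g)
  transpose-currying p q ev r s f g curries k p∘k≈g∘r q∘k≈s =
    ♯-resp-≈ (ev ∘Q ♭ k) (♭ f)
      (curries (♭ k) (♯-reflects-≈ (p ∘Q ♭ k) (g ∘Q Υ⋄₁ r) p∘k≈g∘r)
                     (♯-reflects-≈ (q ∘Q ♭ k) (♭ s) q∘k≈s))

  untranspose-currying :
    ∀ {A B E P : Quiver ℓ} {X Y : Hypergraph ℓ}
      (p : QuiverHom P E) (q : QuiverHom P A) (ev : QuiverHom P B)
      (r : HypergraphHom Y X) (s : HypergraphHom Y (Υ₀ A)) (f : HypergraphHom Y (Υ₀ B))
      (g : HypergraphHom X (Υ₀ E)) →
    Curries (HypergraphCat ℓ) (Υ₁ p) (Υ₁ q) (Υ₁ ev) r s f g →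
    Curries (QuiverCat ℓ) p q ev (Υ⋄₁ r) (♭ s) (♭ f) (♭ g)
  untranspose-currying p q ev r s f g curries k p∘k≈g∘r q∘k≈s =
    ♯-reflects-≈ (ev ∘Q k) (♭ f)
      (curries (♯ k) (♯-resp-≈ (p ∘Q k) (♭ g ∘Q Υ⋄₁ r) p∘k≈g∘r)
                     (♯-resp-≈ (q ∘Q k) (♭ s) q∘k≈s))

  Υ-preserves-exponential : ∀ {A B E P} (p : QuiverHom P E) (q : QuiverHom P A)
                              (ev : QuiverHom P B) →
                            UQ.IsExponential p q ev → UH.IsExponential (Υ₁ p) (Υ₁ q) (Υ₁ ev)
  Υ-preserves-exponential p q ev (product , exponential) =
    Υ-preserves-product p q product ,
    λ X r s r×s f →
      let (g , g-curries , g-unique) =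
            exponential (Υ⋄₀ X) (Υ⋄₁ r) (♭ s) (frobenius-reciprocity r s r×s) (♭ f)
      in ♯ g , transpose-currying p q ev r s f g g-curries ,
         λ g′ g′-curries → ♯-resp-≈ (♭ g′) g
           (g-unique (♭ g′) (untranspose-currying p q ev r s f g′ g′-curries))

  -- The classifying map of a mono m in ℜ is the transpose of the
  -- classifying map of the mono Υ⋄(m) in 𝔔.
  module Classification {T Ω : Quiver ℓ} (true : QuiverHom T Ω)
                        (classifier : UQ.IsSubobjectClassifier true)
                        {A B : Hypergraph ℓ} (m : HypergraphHom A B) (mono : UH.IsMono m)
                        (! : HypergraphHom A (Υ₀ T)) where
    χ′ : QuiverHom (Υ⋄₀ B) Ω
    χ′ = proj₁ (proj₂ classifier (Υ⋄₁ m) (Υ⋄-preserves-mono m mono) (♭ !))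

    χ′-pullback : UQ.IsPullback χ′ true (Υ⋄₁ m) (♭ !)
    χ′-pullback = proj₁ (proj₂ (proj₂ classifier (Υ⋄₁ m) (Υ⋄-preserves-mono m mono) (♭ !)))

    χ′-unique : ∀ (ψ′ : QuiverHom (Υ⋄₀ B) Ω) → UQ.IsPullback ψ′ true (Υ⋄₁ m) (♭ !) → ψ′ ≈Q χ′
    χ′-unique = proj₂ (proj₂ (proj₂ classifier (Υ⋄₁ m) (Υ⋄-preserves-mono m mono) (♭ !)))

    χ : HypergraphHom B (Υ₀ Ω)
    χ = ♯ χ′

    -- a cone (a, b) from X transposes to a cone from Υ⋄(X); its
    -- factorisation through Υ⋄(m) preserves sides, hence descends to X
    χ-pullback : UH.IsPullback χ (Υ₁ true) m !
    χ-pullback = ♯-resp-≈ (χ′ ∘Q Υ⋄₁ m) (true ∘Q ♭ !) (proj₁ χ′-pullback) ,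
      λ X a b commutes → descend-factorisation X a b
        (proj₂ χ′-pullback (Υ⋄₀ X) (Υ⋄₁ a) (♭ b)
          (♯-reflects-≈ (χ′ ∘Q Υ⋄₁ a) (true ∘Q ♭ b) commutes))
      where
        descend-factorisation :
          ∀ X (a : HypergraphHom X B) (b : HypergraphHom X (Υ₀ T)) →
          UniqueFactorisation (QuiverCat ℓ) (Υ⋄₁ m) (♭ !) (Υ⋄₁ a) (♭ b) →
          UniqueFactorisation (HypergraphCat ℓ) m ! a b
        descend-factorisation X a b (u′ , m∘u′≈a , !∘u′≈b , _) =
          u , m∘u≈a , !∘u≈b ,
          λ v m∘v≈a _ → mono v u (HC.≈-trans {f = m ∘H v} {a} {m ∘H u} m∘v≈a
                                    (HC.≈-sym {f = m ∘H u} {a} m∘u≈a))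
          where
            open Descent (descend-through m a u′ m∘u′≈a)
              renaming (lift to u; Υ⋄-lift to Υ⋄u≈u′; lift-over to m∘u≈a)

            !∘u≈b : (! ∘H u) ≈H b
            !∘u≈b = ♯-resp-≈ (♭ ! ∘Q Υ⋄₁ u) (♭ b)
              (QC.≈-trans {f = ♭ ! ∘Q Υ⋄₁ u} {♭ ! ∘Q u′} {♭ b}
                (∘-respʳ (♭ !) {Υ⋄₁ u} {u′} Υ⋄u≈u′) !∘u′≈b)

    -- conversely a pullback square over Υ(true) in ℜ transposes to one in
    -- 𝔔: a cone (a, b) from a quiver Z is decomposed along a, factored in
    -- ℜ, and the factorisation extended back to Z
    untranspose-pullback : ∀ (ψ : HypergraphHom B (Υ₀ Ω)) → UH.IsPullback ψ (Υ₁ true) m ! →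
                           UQ.IsPullback (♭ ψ) true (Υ⋄₁ m) (♭ !)
    untranspose-pullback ψ (square , universal) =
      ♯-reflects-≈ (♭ ψ ∘Q Υ⋄₁ m) (true ∘Q ♭ !) square , factor
      where
        factor : ∀ Z (a : QuiverHom Z (Υ⋄₀ B)) (b : QuiverHom Z T) →
                 (♭ ψ ∘Q a) ≈Q (true ∘Q b) →
                 UniqueFactorisation (QuiverCat ℓ) (Υ⋄₁ m) (♭ !) a b
        factor Z a b commutes = extend (universal parts label b′ label-commutes)
          where
            open Decomposition a

            b′ : HypergraphHom parts (Υ₀ T)
            b′ = ♯ (b ∘Q unpack)

            label-commutes : (ψ ∘H label) ≈H (Υ₁ true ∘H b′)
            label-commutes = ♯-resp-≈ (♭ ψ ∘Q Υ⋄₁ label) (true ∘Q (b ∘Q unpack)) (begin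
              ♭ ψ ∘Q Υ⋄₁ label       ≈⟨ ∘-respʳ (♭ ψ) {Υ⋄₁ label} {a ∘Q unpack} label-spec ⟩
              (♭ ψ ∘Q a) ∘Q unpack   ≈⟨ ∘-respˡ unpack {♭ ψ ∘Q a} {true ∘Q b} commutes ⟩
              (true ∘Q b) ∘Q unpack  ∎)
              where open SetoidReasoning (QuiverHoms (Υ⋄₀ parts) Ω)

            -- uniqueness holds as Υ⋄(m) is mono
            extend : UniqueFactorisation (HypergraphCat ℓ) m ! label b′ →
                     UniqueFactorisation (QuiverCat ℓ) (Υ⋄₁ m) (♭ !) a b
            extend (u₀ , m∘u₀≈label , !∘u₀≈b′ , _) =
              Υ⋄₁ u₀ ∘Q pack , m∘u≈a , extension-transposes ! u₀ b !∘u₀≈b′ ,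
              λ v m∘v≈a _ → Υ⋄-preserves-mono m mono v (Υ⋄₁ u₀ ∘Q pack)
                (QC.≈-trans {f = Υ⋄₁ m ∘Q v} {a} {Υ⋄₁ m ∘Q (Υ⋄₁ u₀ ∘Q pack)} m∘v≈a
                  (QC.≈-sym {f = Υ⋄₁ m ∘Q (Υ⋄₁ u₀ ∘Q pack)} {a} m∘u≈a))
              where
                m∘u≈a : (Υ⋄₁ m ∘Q (Υ⋄₁ u₀ ∘Q pack)) ≈Q a
                m∘u≈a = extension-over m u₀ m∘u₀≈label

    χ-unique : ∀ (ψ : HypergraphHom B (Υ₀ Ω)) → UH.IsPullback ψ (Υ₁ true) m ! → ψ ≈H χ
    χ-unique ψ pullback =
      ♯-resp-≈ (♭ ψ) χ′ (χ′-unique (♭ ψ) (untranspose-pullback ψ pullback))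

  Υ-preserves-subobject-classifier : ∀ {T Ω} (true : QuiverHom T Ω) →
                                     UQ.IsSubobjectClassifier true →
                                     UH.IsSubobjectClassifier (Υ₁ true)
  Υ-preserves-subobject-classifier {T} true classifier =
    Υ-preserves-terminal T (proj₁ classifier) ,
    λ m mono ! → let open Classification true classifier m mono ! in
                 χ , χ-pullback , χ-unique

  Υ-logical : IsLogical (Υ {ℓ})
  Υ-logical = record
    { pres-terminal = Υ-preserves-terminal
    ; pres-pullback = Υ-preserves-pullback
    ; pres-exponential = Υ-preserves-exponential
    ; pres-subobject-classifier = Υ-preserves-subobject-classifier }

mainTheorem18 : (ℓ : Level) →
    ((Q : Quiver ℓ) (G : Hypergraph ℓ) →
      (∀ w → QuiverHom.homV (frobenius Q G) w ≡ frobeniusFormulaV Q G w) ×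
      (∀ e → QuiverHom.homE (frobenius Q G) e ≡ e)) ×
    IsAtomicSurjection (Υ⋄ {ℓ}) (Υ {ℓ}) (Υ⋆ {ℓ}) ×
    ¬ IsEmbedding (Υ⋄ {ℓ}) (Υ {ℓ}) (Υ⋆ {ℓ}) ×
    Faithful (Υ⋄ {ℓ}) ×
    Equivalence (HypergraphCat ℓ) (Slice (QuiverCat ℓ) (ArrowQuiver ℓ))
mainTheorem18 ℓ =
  (λ Q G → frobenius-vertices Q G , (λ _ → refl)) ,
  ((Υ⋄⊣Υ , Υ⊣Υ⋆) , Υ-logical , Υ-faithful) ,
  Υ-not-embedding ,
  Υ⋄-faithful ,
  hypergraphs≃quiversOverArrow
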